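{- Let $d\ge 1$ and $n$ be such that $2^d+d=n/2$. Then there is a Las Vegas probabilistic OBDD computing $\mathtt{SSA}_n$ with error bound $1/2$ of width at most $2^{2^d/2+d+3}$, i.e. $\mathsf{LV\text{ - }OBDD}_{0.5}(\mathtt{SSA}_n)\le 2^{2^d/2+d+3}$.
   Context: Shuffled Storage Access function $\mathtt{SSA}_n:\{0,1\}^n\to\{0,1\}$ ($n$ even, $2^d+d=n/2$): for input $x$, let $I_0=(2i_1<\dots<2i_m)$ be the sorted list of even indices $2i$ with $x_{2i-1}=0$ and $I_1=(2j_1<\dots<2j_k)$ the sorted list of even indices $2i$ with $x_{2i-1}=1$. Let $\mathtt{ShiftX}((a_1,\dots,a_t),b)=(a_2,\dots,a_t,a_1\oplus b)$. Start with $\alpha=0^{2^d}$ and for $r=1,\dots,m$ set $\alpha:=\mathtt{ShiftX}(\alpha,x_{2i_r})$; start with $\beta=0^d$ and for $r=1,\dots,k$ set $\beta:=\mathtt{ShiftX}(\beta,x_{2j_r})$. Then $\mathtt{SSA}_n(x)$ is the bit of $\alpha$ at the address encoded in binary by $\beta$. A probabilistic OBDD of width $m$ over $x_1,\dots,x_n$: a permutation $\pi$ of $\{1,\dots,n\}$, a state set $S$ of size $m$, an initial probability distribution $v_0$ on $S$, and for each step $j$ two $m\times m$ column-stochastic matrices $T_j^0,T_j^1$; the distribution after step $j$ is $v_j=T_j^{x_{\pi(j)}}v_{j-1}$. In a Las Vegas POBDD, $S$ is partitioned into accepting, rejecting and neutral ("don't know") states; it computes $f$ with error bound $\varepsilon$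 if for every input the final distribution gives probability $0$ to states giving the wrong answer and probability at least $1-\varepsilon$ to states giving the correct answer $f(x)$. $\mathsf{LV\text{ - }OBDD}_{\varepsilon}(f)$ is the minimum width of such a program. -}

module Defs where

open import Data.Bool using (Bool; true; false; if_then_else_; _xor_)
open import Data.Nat using (ℕ; zero; suc; _+_; _*_; _^_; _≤_)
open import Data.Nat.DivMod using (_/_)
open import Data.Fin using (Fin; zero; suc)
open import Data.Fin.Permutation using (Permutation′; _⟨$⟩ʳ_)
open import Data.List using (List; []; _∷_; _++_; [_]; foldl; replicate; allFin)
open import Data.Product using (_×_; _,_; proj₁; proj₂; Σ; ∃)
open import Data.Vec.Functional using (toList)
open import Data.Rational using (ℚ; 0ℚ; 1ℚ) renaming (_+_ to _+ℚ_; _*_ to _*ℚ_; _-_ to _-ℚ_; _≤_ to _≤ℚ_)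
open import Relation.Binary.PropositionalEquality using (_≡_)

shiftX : List Bool → Bool → List Bool
shiftX []       b = []
shiftX (a ∷ as) b = as ++ [ a xor b ]

pairs : List Bool → List (Bool × Bool)
pairs (a ∷ b ∷ r) = (a , b) ∷ pairs r
pairs _           = []

-- process the pairs in increasing order of i: control bit x_{2i-1}
-- selects α (0) or β (1); data bit x_{2i} is shifted in.
ssaStep : List Bool × List Bool → Bool × Bool → List Bool × List Bool
ssaStep (α , β) (false , b) = (shiftX α b , β)
ssaStep (α , β) (true  , b) = (α , shiftX β b)

-- binary number encoded by a bit list, first bit most significant
binVal : List Bool → ℕ
binVal = foldl (λ acc b → 2 * acc + (if b then 1 else 0)) 0

-- bit at (0-based) address k
bitAt : List Bool → ℕ → Bool
bitAt []       _       = false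
bitAt (a ∷ _)  zero    = a
bitAt (_ ∷ as) (suc k) = bitAt as k

SSA : ℕ → List Bool → Bool
SSA d xs =
  let r = foldl ssaStep (replicate (2 ^ d) false , replicate d false) (pairs xs)
  in bitAt (proj₁ r) (binVal (proj₂ r))

Σℚ : (m : ℕ) → (Fin m → ℚ) → ℚ
Σℚ zero    f = 0ℚ
Σℚ (suc m) f = f zero +ℚ Σℚ m (λ i → f (suc i))

data Answer : Set where
  accept reject neutral : Answer

-- Las Vegas POBDD of width m over x₁ … x_n (variable x_{k+1} ↦ Fin index k)
record LVPOBDD (n m : ℕ) : Set where
  field
    π        : Permutation′ n
    v₀       : Fin m → ℚ
    -- T j b s' s : probability to move from state s to state s' at step j
    -- when the read bit x_{π(j)} equals b  (column s is a distribution)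
    T        : Fin n → Bool → Fin m → Fin m → ℚ
    label    : Fin m → Answer
    v₀-nonneg : ∀ s → 0ℚ ≤ℚ v₀ s
    v₀-sum    : Σℚ m v₀ ≡ 1ℚ
    T-nonneg  : ∀ j b s' s → 0ℚ ≤ℚ T j b s' s
    T-colsum  : ∀ j b s → Σℚ m (λ s' → T j b s' s) ≡ 1ℚ

sameAns : Answer → Answer → Bool
sameAns accept  accept  = true
sameAns reject  reject  = true
sameAns neutral neutral = true
sameAns _       _       = false

module _ {n m : ℕ} (P : LVPOBDD n m) where
  open LVPOBDD P

  applyM : (Fin m → Fin m → ℚ) → (Fin m → ℚ) → (Fin m → ℚ)
  applyM M v s' = Σℚ m (λ s → M s' s *ℚ v s)

  finalDist : (Fin n → Bool) → Fin m → ℚ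
  finalDist x = foldl (λ v j → applyM (T j (x (π ⟨$⟩ʳ j))) v) v₀ (allFin n)

  probOf : Answer → (Fin n → Bool) → ℚ
  probOf a x = Σℚ m (λ s → if sameAns (label s) a then finalDist x s else 0ℚ)

  correct wrong : Bool → Answer
  correct true  = accept
  correct false = reject
  wrong   true  = reject
  wrong   false = accept

  Computes : (ε : ℚ) → ((Fin n → Bool) → Bool) → Set
  Computes ε f = ∀ x → (probOf (wrong (f x)) x ≡ 0ℚ)
                     × (1ℚ -ℚ ε ≤ℚ probOf (correct (f x)) x)

LV-OBDD≤ : (n : ℕ) → ℚ → ((Fin n → Bool) → Bool) → ℕ → Set
LV-OBDD≤ n ε f w = Σ ℕ λ m → (m ≤ w) × Σ (LVPOBDD n m) λ P → Computes P ε f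

SSAₙ : ℕ → (n : ℕ) → (Fin n → Bool) → Bool
SSAₙ d n x = SSA d (toList x)

-- Flip a fair coin p₀ and keep, instead of the whole register α of length 2^d, only its
-- entries at positions of one parity, together with β, the parity currently kept, the
-- reading phase and the last control bit: 2^d/2 + d + 3 bits of state. A shift of α moves
-- every entry down by one position, so the kept half is always the half of parity
-- p₀ xor (number of shifts so far) of the current α, and it is maintained exactly. At the
-- end the program outputs α[β] if β addresses the kept half and "don't know" otherwise.
-- For every input exactly one of the two coin outcomes commits, and it commits to the
-- right value, so the program never errs and answers with probability 1/2.

module Submission where

open import Algebra.Bundles using (CommutativeMonoid)
open import Data.Bool using (Bool; true; false; not; if_then_else_; _xor_)
open import Data.Bool.Properties as Bool using (not-distribʳ-xor; xor-same; xor-inverseʳ; not-involutive; ¬-not)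
open import Data.Fin using (Fin; zero; suc; combine; remQuot)
open import Data.Fin.Properties using (_≟_; remQuot-combine; 2↔Bool)
open import Data.Fin.Permutation using () renaming (id to idₚ)
open import Data.List using (List; []; _∷_; _++_; [_]; foldl; map; length; take; drop; replicate; allFin)
open import Data.List.Properties using (length-++; length-replicate; map-tabulate; foldl-map)
open import Data.Nat using (ℕ; zero; suc; _+_; _*_; _^_; _≤_; ⌊_/2⌋)
open import Data.Nat.DivMod using (_/_; m*n/n≡m)
open import Data.Nat.Properties using (≤-refl; +-suc; +-comm; +-identityʳ; *-comm; suc-injective)
open import Data.Product using (_×_; _,_; proj₁; proj₂)
open import Data.Rational using (ℚ; 0ℚ; 1ℚ; ½)
  renaming (_+_ to _+ℚ_; _*_ to _*ℚ_; _-_ to _-ℚ_; _≤_ to _≤ℚ_)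
import Data.Rational.Properties as ℚ
open import Data.Rational.Solver using (module +-*-Solver)
open import Data.Sum using (_⊎_; inj₁; inj₂)
open import Function using (_∘_; Inverse)
open import Relation.Binary.PropositionalEquality hiding ([_])
open import Relation.Nullary.Decidable using (does; yes; no)
open import Defs

open import Algebra.Properties.CommutativeSemigroup
  (CommutativeMonoid.commutativeSemigroup ℚ.+-0-commutativeMonoid) using (interchange)

foldl-simulation : ∀ {a b c r} {A : Set a} {B : Set b} {C : Set c}
                   (R : A → B → Set r) {f : A → C → A} {g : B → C → B} →
                   (∀ {x y} z → R x y → R (f x z) (g y z)) →
                   ∀ zs {x y} → R x y → R (foldl f x zs) (foldl g y zs)
foldl-simulation R step []       r = r
foldl-simulation R step (z ∷ zs) r = foldl-simulation R step zs (step z r)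

Σℚ-cong : ∀ m {f g : Fin m → ℚ} → (∀ i → f i ≡ g i) → Σℚ m f ≡ Σℚ m g
Σℚ-cong zero    f≗g = refl
Σℚ-cong (suc m) f≗g = cong₂ _+ℚ_ (f≗g zero) (Σℚ-cong m (f≗g ∘ suc))

Σℚ-zero : ∀ m → Σℚ m (λ _ → 0ℚ) ≡ 0ℚ
Σℚ-zero zero    = refl
Σℚ-zero (suc m) = trans (cong (0ℚ +ℚ_) (Σℚ-zero m)) (ℚ.+-identityˡ 0ℚ)

Σℚ-+ : ∀ m (f g : Fin m → ℚ) → Σℚ m (λ i → f i +ℚ g i) ≡ Σℚ m f +ℚ Σℚ m g
Σℚ-+ zero    f g = refl
Σℚ-+ (suc m) f g =
  trans (cong (f zero +ℚ g zero +ℚ_) (Σℚ-+ m (f ∘ suc) (g ∘ suc))) (interchange (f zero) (g zero) (Σℚ m (f ∘ suc)) (Σℚ m (g ∘ suc)))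

Σℚ-*ˡ : ∀ m c (f : Fin m → ℚ) → Σℚ m (λ i → c *ℚ f i) ≡ c *ℚ Σℚ m f
Σℚ-*ˡ zero    c f = sym (ℚ.*-zeroʳ c)
Σℚ-*ˡ (suc m) c f =
  trans (cong (c *ℚ f zero +ℚ_) (Σℚ-*ˡ m c (f ∘ suc))) (sym (ℚ.*-distribˡ-+ c _ _))

indicator : Bool → ℚ
indicator true  = 1ℚ
indicator false = 0ℚ

indicator-nonneg : ∀ b → 0ℚ ≤ℚ indicator b
indicator-nonneg true  = ℚ.nonNegative⁻¹ 1ℚ
indicator-nonneg false = ℚ.≤-refl

if-then-0≡indicator-* : ∀ b q → (if b then q else 0ℚ) ≡ indicator b *ℚ q
if-then-0≡indicator-* true  q = sym (ℚ.*-identityˡ q)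
if-then-0≡indicator-* false q = sym (ℚ.*-zeroˡ q)

kronecker : ∀ {m} → Fin m → Fin m → ℚ
kronecker i j = indicator (does (i ≟ j))

Σℚ-kronecker : ∀ m (f : Fin m → ℚ) j → Σℚ m (λ i → f i *ℚ kronecker i j) ≡ f j
Σℚ-kronecker (suc m) f zero = begin
  f zero *ℚ 1ℚ +ℚ Σℚ m (λ i → f (suc i) *ℚ 0ℚ)
    ≡⟨ cong₂ _+ℚ_ (ℚ.*-identityʳ (f zero)) (Σℚ-cong m (ℚ.*-zeroʳ ∘ f ∘ suc)) ⟩
  f zero +ℚ Σℚ m (λ _ → 0ℚ)
    ≡⟨ cong (f zero +ℚ_) (Σℚ-zero m) ⟩
  f zero +ℚ 0ℚ
    ≡⟨ ℚ.+-identityʳ (f zero) ⟩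
  f zero ∎
  where open ≡-Reasoning
Σℚ-kronecker (suc m) f (suc j) =
  trans (cong₂ _+ℚ_ (ℚ.*-zeroʳ (f zero)) (Σℚ-kronecker m (f ∘ suc) j)) (ℚ.+-identityˡ (f (suc j)))

Σℚ-kronecker-one : ∀ m (j : Fin m) → Σℚ m (λ i → kronecker i j) ≡ 1ℚ
Σℚ-kronecker-one m j =
  trans (Σℚ-cong m (λ i → sym (ℚ.*-identityˡ (kronecker i j)))) (Σℚ-kronecker m (λ _ → 1ℚ) j)

average : ℚ → ℚ → ℚ
average p q = ½ *ℚ p +ℚ ½ *ℚ q

coin : ∀ {m} → Fin m → Fin m → Fin m → ℚ
coin a b s = average (kronecker s a) (kronecker s b)

coin-nonneg : ∀ {m} (a b s : Fin m) → 0ℚ ≤ℚ coin a b s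
coin-nonneg a b s with does (s ≟ a) | does (s ≟ b)
... | true  | true  = ℚ.nonNegative⁻¹ _
... | true  | false = ℚ.nonNegative⁻¹ _
... | false | true  = ℚ.nonNegative⁻¹ _
... | false | false = ℚ.≤-refl

Σℚ-coin : ∀ m (f : Fin m → ℚ) a b → Σℚ m (λ s → f s *ℚ coin a b s) ≡ average (f a) (f b)
Σℚ-coin m f a b = begin
  Σℚ m (λ s → f s *ℚ coin a b s)
    ≡⟨ Σℚ-cong m (λ s → distrib (f s) ½ (kronecker s a) (kronecker s b)) ⟩
  Σℚ m (λ s → ½ *ℚ (f s *ℚ kronecker s a) +ℚ ½ *ℚ (f s *ℚ kronecker s b))
    ≡⟨ Σℚ-+ m _ _ ⟩
  Σℚ m (λ s → ½ *ℚ (f s *ℚ kronecker s a)) +ℚ Σℚ m (λ s → ½ *ℚ (f s *ℚ kronecker s b))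
    ≡⟨ cong₂ _+ℚ_ (Σℚ-*ˡ m ½ _) (Σℚ-*ˡ m ½ _) ⟩
  average (Σℚ m (λ s → f s *ℚ kronecker s a)) (Σℚ m (λ s → f s *ℚ kronecker s b))
    ≡⟨ cong₂ average (Σℚ-kronecker m f a) (Σℚ-kronecker m f b) ⟩
  average (f a) (f b) ∎
  where
  open ≡-Reasoning
  open +-*-Solver
  distrib : ∀ x h u v → x *ℚ (h *ℚ u +ℚ h *ℚ v) ≡ h *ℚ (x *ℚ u) +ℚ h *ℚ (x *ℚ v)
  distrib = solve 4 (λ x h u v → x :* (h :* u :+ h :* v) := h :* (x :* u) :+ h :* (x :* v)) refl

Σℚ-coin-one : ∀ m (a b : Fin m) → Σℚ m (coin a b) ≡ 1ℚ
Σℚ-coin-one m a b =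
  trans (Σℚ-cong m (λ s → sym (ℚ.*-identityˡ (coin a b s)))) (Σℚ-coin m (λ _ → 1ℚ) a b)

-- A deterministic automaton started at one of two states by a fair coin

answer : Bool → Answer
answer true  = accept
answer false = reject

OneCommitsTo : Bool → Answer → Answer → Set
OneCommitsTo v ℓ₀ ℓ₁ = (ℓ₀ ≡ answer v × ℓ₁ ≡ neutral) ⊎ (ℓ₀ ≡ neutral × ℓ₁ ≡ answer v)

module CoinFlipAutomaton {n m : ℕ} (δ : Fin m → Bool → Fin m) (start : Bool → Fin m)
                         (label : Fin m → Answer) where

  pobdd : LVPOBDD n m
  pobdd = record
    { π         = idₚ
    ; v₀        = coin (start false) (start true)
    ; T         = λ _ x s′ s → kronecker s′ (δ s x)
    ; label     = label
    ; v₀-nonneg = coin-nonneg (start false) (start true)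
    ; v₀-sum    = Σℚ-coin-one m (start false) (start true)
    ; T-nonneg  = λ _ x s′ s → indicator-nonneg (does (s′ ≟ δ s x))
    ; T-colsum  = λ _ x s → Σℚ-kronecker-one m (δ s x)
    }

  word : (Fin n → Bool) → List Bool
  word x = map x (allFin n)

  final : Bool → (Fin n → Bool) → Fin m
  final p x = foldl δ (start p) (word x)

  finalDist-coin : ∀ x s → finalDist pobdd x s ≡ coin (final false x) (final true x) s
  finalDist-coin x s =
    trans (fold-coin (allFin n) (λ _ → refl) s)
          (cong₂ (λ a b → coin a b s) (sym (foldl-map δ x _ (allFin n))) (sym (foldl-map δ x _ (allFin n))))
    where
    fold-coin : ∀ js {v a b} → (∀ s → v s ≡ coin a b s) → ∀ s →
                foldl (λ v j → applyM pobdd (LVPOBDD.T pobdd j (x j)) v) v js s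
                  ≡ coin (foldl (λ t j → δ t (x j)) a js) (foldl (λ t j → δ t (x j)) b js) s
    fold-coin []       v≗coin = v≗coin
    fold-coin (j ∷ js) v≗coin = fold-coin js λ s′ →
      trans (Σℚ-cong m (λ s → cong (kronecker s′ (δ s (x j)) *ℚ_) (v≗coin s)))
            (Σℚ-coin m (λ s → kronecker s′ (δ s (x j))) _ _)

  probOf-coin : ∀ ans x → probOf pobdd ans x
                  ≡ average (indicator (sameAns (label (final false x)) ans))
                            (indicator (sameAns (label (final true x)) ans))
  probOf-coin ans x =
    trans (Σℚ-cong m (λ s → trans (if-then-0≡indicator-* (sameAns (label s) ans) _)
                                  (cong (indicator (sameAns (label s) ans) *ℚ_) (finalDist-coin x s))))
          (Σℚ-coin m (λ s → indicator (sameAns (label s) ans)) _ _)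

  coin-verdict : ∀ v {ℓ₀ ℓ₁} → OneCommitsTo v ℓ₀ ℓ₁ →
    (average (indicator (sameAns ℓ₀ (wrong pobdd v))) (indicator (sameAns ℓ₁ (wrong pobdd v))) ≡ 0ℚ)
    × (1ℚ -ℚ ½ ≤ℚ average (indicator (sameAns ℓ₀ (correct pobdd v))) (indicator (sameAns ℓ₁ (correct pobdd v))))
  coin-verdict true  (inj₁ (refl , refl)) = refl , ℚ.≤-refl
  coin-verdict false (inj₁ (refl , refl)) = refl , ℚ.≤-refl
  coin-verdict true  (inj₂ (refl , refl)) = refl , ℚ.≤-refl
  coin-verdict false (inj₂ (refl , refl)) = refl , ℚ.≤-refl

  computes : (f : (Fin n → Bool) → Bool) →
             (∀ x → OneCommitsTo (f x) (label (final false x)) (label (final true x))) →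
             Computes pobdd ½ f
  computes f commits x =
    trans (probOf-coin _ x) (proj₁ verdict) , subst (1ℚ -ℚ ½ ≤ℚ_) (sym (probOf-coin _ x)) (proj₂ verdict)
    where verdict = coin-verdict (f x) (commits x)

-- Halves of a register of even length

data Paired {a} {A : Set a} : ℕ → List A → Set a where
  []   : Paired 0 []
  pair : ∀ {k x y xs} → Paired k xs → Paired (suc k) (x ∷ y ∷ xs)

paired-length : ∀ {a} {A : Set a} {k} {xs : List A} → Paired k xs → length xs ≡ k + k
paired-length []                 = refl
paired-length (pair {k = k} ps) = cong suc (trans (cong suc (paired-length ps)) (sym (+-suc k k)))

length⇒paired : ∀ {a} {A : Set a} k (xs : List A) → length xs ≡ k + k → Paired k xs
length⇒paired zero    []           _   = []
length⇒paired (suc k) (x ∷ [])     eq with trans (suc-injective eq) (+-suc k k)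
... | ()
length⇒paired (suc k) (x ∷ y ∷ xs) eq =
  pair (length⇒paired k xs (suc-injective (trans (suc-injective eq) (+-suc k k))))

atParity : ∀ {a} {A : Set a} → Bool → List A → List A
atParity _     []       = []
atParity false (x ∷ xs) = x ∷ atParity true xs
atParity true  (x ∷ xs) = atParity false xs

module _ {a} {A : Set a} where

  atParity-∷∷ : ∀ p (x y : A) xs → atParity p (x ∷ y ∷ xs) ≡ (if p then y else x) ∷ atParity p xs
  atParity-∷∷ false x y xs = refl
  atParity-∷∷ true  x y xs = refl

  length-atParity : ∀ p {k} {xs : List A} → Paired k xs → length (atParity p xs) ≡ k
  length-atParity p     []        = refl
  length-atParity false (pair ps) = cong suc (length-atParity false ps)
  length-atParity true  (pair ps) = cong suc (length-atParity true ps)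

  atParity-even-++ : ∀ {k} {xs : List A} z → Paired k xs →
                     atParity false (xs ++ [ z ]) ≡ atParity false xs ++ [ z ]
  atParity-even-++ z []                    = refl
  atParity-even-++ z (pair {x = x} ps) = cong (x ∷_) (atParity-even-++ z ps)

  atParity-odd-++ : ∀ {k} {xs : List A} z → Paired k xs →
                    atParity true (xs ++ [ z ]) ≡ atParity true xs
  atParity-odd-++ z []                    = refl
  atParity-odd-++ z (pair {y = y} ps) = cong (y ∷_) (atParity-odd-++ z ps)

length-shiftX : ∀ xs b → length (shiftX xs b) ≡ length xs
length-shiftX []       b = refl
length-shiftX (x ∷ xs) b = trans (length-++ xs) (+-comm (length xs) 1)

paired-shiftX : ∀ {k xs} b → Paired k xs → Paired k (shiftX xs b)
paired-shiftX {k} {xs} b ps = length⇒paired k _ (trans (length-shiftX xs b) (paired-length ps))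

shiftHalf : Bool → List Bool → Bool → List Bool
shiftHalf false xs b = shiftX xs b
shiftHalf true  xs b = xs

atParity-shiftX : ∀ p {k xs} b → Paired k xs →
                  atParity (not p) (shiftX xs b) ≡ shiftHalf p (atParity p xs) b
atParity-shiftX false b []                  = refl
atParity-shiftX true  b []                  = refl
atParity-shiftX false b (pair {x = x} ps)  = atParity-even-++ (x xor b) ps
atParity-shiftX true  b (pair {x = x} {y} ps) = cong (y ∷_) (atParity-odd-++ (x xor b) ps)

odd : ℕ → Bool
odd zero          = false
odd (suc zero)    = true
odd (suc (suc i)) = odd i

bitAt-atParity : ∀ {k xs} → Paired k xs → ∀ i → bitAt (atParity (odd i) xs) ⌊ i /2⌋ ≡ bitAt xs i
bitAt-atParity []   i             = refl
bitAt-atParity (pair ps) zero    = refl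
bitAt-atParity (pair ps) (suc zero) = refl
bitAt-atParity (pair {x = x} {y} {xs} ps) (suc (suc i)) =
  trans (cong (λ ys → bitAt ys (suc ⌊ i /2⌋)) (atParity-∷∷ (odd i) x y xs)) (bitAt-atParity ps i)

-- SSA read one bit at a time, and its compressed version

record Scan : Set where
  constructor scan
  field
    α β         : List Bool
    readingData : Bool
    control     : Bool
    shiftParity : Bool

scanStep : Scan → Bool → Scan
scanStep (scan α β false _     q) x = scan α β true x q
scanStep (scan α β true  false q) x = scan (shiftX α x) β false false (not q)
scanStep (scan α β true  true  q) x = scan α (shiftX β x) false false q

registers : Scan → List Bool × List Bool
registers (scan α β _ _ _) = α , β

registers-scan : ∀ xs α β c q →
                 registers (foldl scanStep (scan α β false c q) xs) ≡ foldl ssaStep (α , β) (pairs xs)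
registers-scan []                α β c q = refl
registers-scan (x ∷ [])          α β c q = refl
registers-scan (false ∷ y ∷ xs)  α β c q = registers-scan xs (shiftX α y) β false (not q)
registers-scan (true  ∷ y ∷ xs)  α β c q = registers-scan xs α (shiftX β y) false q

record Stored : Set where
  constructor stored
  field
    readingData : Bool
    control     : Bool
    keptParity  : Bool
    β kept      : List Bool

storedStep : Stored → Bool → Stored
storedStep (stored false _     p β S) x = stored true x p β S
storedStep (stored true  false p β S) x = stored false false (not p) β (shiftHalf p S x)
storedStep (stored true  true  p β S) x = stored false false p (shiftX β x) S

compress : Bool → Scan → Stored
compress p₀ (scan α β r c q) = stored r c (p₀ xor q) β (atParity (p₀ xor q) α)

storedStep-compress : ∀ {k} p₀ e x → Paired k (Scan.α e) →
                      storedStep (compress p₀ e) x ≡ compress p₀ (scanStep e x)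
storedStep-compress p₀ (scan α β false c q) x _ = refl
storedStep-compress p₀ (scan α β true true q) x _ = refl
storedStep-compress p₀ (scan α β true false q) x α-paired rewrite sym (not-distribʳ-xor p₀ q) =
  cong (stored false false _ β) (sym (atParity-shiftX (p₀ xor q) x α-paired))

verdict : Stored → Answer
verdict (stored _ _ p β S) =
  if odd (binVal β) xor p then neutral else answer (bitAt S ⌊ binVal β /2⌋)

verdict-match : ∀ {k α} r c β → Paired k α →
                verdict (stored r c (odd (binVal β)) β (atParity (odd (binVal β)) α)) ≡ answer (bitAt α (binVal β))
verdict-match r c β α-paired rewrite xor-same (odd (binVal β)) = cong answer (bitAt-atParity α-paired (binVal β))

verdict-mismatch : ∀ r c β S → verdict (stored r c (not (odd (binVal β))) β S) ≡ neutral
verdict-mismatch r c β S rewrite xor-inverseʳ (odd (binVal β)) = refl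

compress-verdicts : ∀ {k} e → Paired k (Scan.α e) →
  OneCommitsTo (bitAt (Scan.α e) (binVal (Scan.β e))) (verdict (compress false e)) (verdict (compress true e))
compress-verdicts (scan α β r c q) α-paired with q Bool.≟ odd (binVal β)
... | yes refl = inj₁ (verdict-match r c β α-paired , verdict-mismatch r c β (atParity (not q) α))
... | no q≢ rewrite ¬-not q≢ | not-involutive (odd (binVal β)) =
  inj₂ (verdict-mismatch r c β (atParity (not (odd (binVal β))) α) , verdict-match r c β α-paired)

bitsToFin : ∀ k → List Bool → Fin (2 ^ k)
bitsToFin zero    _        = zero
bitsToFin (suc k) []       = combine {2} zero (bitsToFin k [])
bitsToFin (suc k) (x ∷ xs) = combine (Inverse.from 2↔Bool x) (bitsToFin k xs)

finToBits : ∀ k → Fin (2 ^ k) → List Bool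
finToBits zero    _ = []
finToBits (suc k) i = Inverse.to 2↔Bool (proj₁ (remQuot {2} (2 ^ k) i)) ∷ finToBits k (proj₂ (remQuot {2} (2 ^ k) i))

finToBits-bitsToFin : ∀ k xs → length xs ≡ k → finToBits k (bitsToFin k xs) ≡ xs
finToBits-bitsToFin zero    []       _  = refl
finToBits-bitsToFin (suc k) (x ∷ xs) eq = cong₂ _∷_
  (trans (cong (λ z → Inverse.to 2↔Bool (proj₁ z)) split) (Inverse.strictlyInverseˡ 2↔Bool x))
  (trans (cong (λ z → finToBits k (proj₂ z)) split) (finToBits-bitsToFin k xs (suc-injective eq)))
  where split = remQuot-combine {2} {2 ^ k} (Inverse.from 2↔Bool x) (bitsToFin k xs)

take-length-++ : ∀ {a} {A : Set a} (xs ys : List A) → take (length xs) (xs ++ ys) ≡ xs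
take-length-++ []       ys = refl
take-length-++ (x ∷ xs) ys = cong (x ∷_) (take-length-++ xs ys)

drop-length-++ : ∀ {a} {A : Set a} (xs ys : List A) → drop (length xs) (xs ++ ys) ≡ ys
drop-length-++ []       ys = refl
drop-length-++ (x ∷ xs) ys = drop-length-++ xs ys

module StoredEncoding (d h : ℕ) where

  width : ℕ
  width = h + d + 3

  flatten : Stored → List Bool
  flatten (stored r c p β S) = r ∷ c ∷ p ∷ β ++ S

  unflatten : List Bool → Stored
  unflatten (r ∷ c ∷ p ∷ bs) = stored r c p (take d bs) (drop d bs)
  unflatten _                = stored false false false [] []

  encode : Stored → Fin (2 ^ width)
  encode = bitsToFin width ∘ flatten

  decode : Fin (2 ^ width) → Stored
  decode = unflatten ∘ finToBits width

  length-flatten : ∀ r c p β S → length β ≡ d → length S ≡ h →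
                   length (flatten (stored r c p β S)) ≡ width
  length-flatten r c p β S β-len S-len =
    trans (cong (3 +_) (trans (length-++ β) (cong₂ _+_ β-len S-len)))
          (trans (+-comm 3 (d + h)) (cong (_+ 3) (+-comm d h)))

  unflatten-flatten : ∀ r c p β S → length β ≡ d → unflatten (flatten (stored r c p β S)) ≡ stored r c p β S
  unflatten-flatten r c p β S β-len rewrite sym β-len =
    cong₂ (stored r c p) (take-length-++ β S) (drop-length-++ β S)

  decode-encode : ∀ r c p β S → length β ≡ d → length S ≡ h →
                  decode (encode (stored r c p β S)) ≡ stored r c p β S
  decode-encode r c p β S β-len S-len =
    trans (cong unflatten (finToBits-bitsToFin width _ (length-flatten r c p β S β-len S-len)))
          (unflatten-flatten r c p β S β-len)

half-double : ∀ d → 1 ≤ d → 2 ^ d / 2 + 2 ^ d / 2 ≡ 2 ^ d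
half-double (suc d) _ = begin
  2 * 2 ^ d / 2 + 2 * 2 ^ d / 2 ≡⟨ cong (λ t → t / 2 + t / 2) (*-comm 2 (2 ^ d)) ⟩
  2 ^ d * 2 / 2 + 2 ^ d * 2 / 2 ≡⟨ cong (λ t → t + t) (m*n/n≡m (2 ^ d) 2) ⟩
  2 ^ d + 2 ^ d                 ≡⟨ cong (2 ^ d +_) (sym (+-identityʳ (2 ^ d))) ⟩
  2 * 2 ^ d                     ∎
  where open ≡-Reasoning

module SSAProgram (d n : ℕ) (1≤d : 1 ≤ d) where

  h : ℕ
  h = 2 ^ d / 2

  open StoredEncoding d h public using (width)
  open StoredEncoding d h using (encode; decode; decode-encode)

  WellSized : Scan → Set
  WellSized e = Paired h (Scan.α e) × length (Scan.β e) ≡ d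

  wellSized-step : ∀ e x → WellSized e → WellSized (scanStep e x)
  wellSized-step (scan α β false c q)    x sized              = sized
  wellSized-step (scan α β true false q) x (α-paired , β-len) = paired-shiftX x α-paired , β-len
  wellSized-step (scan α β true true q)  x (α-paired , β-len) = α-paired , trans (length-shiftX β x) β-len

  decode-encode-compress : ∀ p₀ e → WellSized e → decode (encode (compress p₀ e)) ≡ compress p₀ e
  decode-encode-compress p₀ (scan α β r c q) (α-paired , β-len) =
    decode-encode r c (p₀ xor q) β _ β-len (length-atParity (p₀ xor q) α-paired)

  initial : Scan
  initial = scan (replicate (2 ^ d) false) (replicate d false) false false false

  initial-wellSized : WellSized initial
  initial-wellSized =
    length⇒paired h _ (trans (length-replicate (2 ^ d)) (sym (half-double d 1≤d))) , length-replicate d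

  δ : Fin (2 ^ width) → Bool → Fin (2 ^ width)
  δ s x = encode (storedStep (decode s) x)

  open CoinFlipAutomaton {n} δ (λ p₀ → encode (compress p₀ initial)) (verdict ∘ decode) public

  Encodes : Bool → Scan → Fin (2 ^ width) → Set
  Encodes p₀ e s = WellSized e × s ≡ encode (compress p₀ e)

  encodes-step : ∀ p₀ {e s} x → Encodes p₀ e s → Encodes p₀ (scanStep e x) (δ s x)
  encodes-step p₀ {e} x (sized , refl) = wellSized-step e x sized , (begin
    encode (storedStep (decode (encode (compress p₀ e))) x)
      ≡⟨ cong (λ t → encode (storedStep t x)) (decode-encode-compress p₀ e sized) ⟩
    encode (storedStep (compress p₀ e) x)
      ≡⟨ cong encode (storedStep-compress p₀ e x (proj₁ sized)) ⟩
    encode (compress p₀ (scanStep e x)) ∎)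
    where open ≡-Reasoning

  finalScan : (Fin n → Bool) → Scan
  finalScan x = foldl scanStep initial (word x)

  final-encodes : ∀ p₀ x → Encodes p₀ (finalScan x) (final p₀ x)
  final-encodes p₀ x = foldl-simulation (Encodes p₀) (encodes-step p₀) (word x) (initial-wellSized , refl)

  verdict-final : ∀ p₀ x → verdict (decode (final p₀ x)) ≡ verdict (compress p₀ (finalScan x))
  verdict-final p₀ x with final-encodes p₀ x
  ... | sized , eq rewrite eq = cong verdict (decode-encode-compress p₀ (finalScan x) sized)

  SSA≡finalScan : ∀ x → SSAₙ d n x ≡ bitAt (Scan.α (finalScan x)) (binVal (Scan.β (finalScan x)))
  SSA≡finalScan x =
    cong (λ r → bitAt (proj₁ r) (binVal (proj₂ r)))
         (trans (cong (foldl ssaStep _ ∘ pairs) (sym (map-tabulate (λ i → i) x)))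
                (sym (registers-scan (word x) _ _ false false)))

  ssa-commits : ∀ x → OneCommitsTo (SSAₙ d n x) (verdict (decode (final false x))) (verdict (decode (final true x)))
  ssa-commits x rewrite SSA≡finalScan x | verdict-final false x | verdict-final true x =
    compress-verdicts (finalScan x) (proj₁ (proj₁ (final-encodes false x)))

theorem6 : (d n : ℕ) → 1 ≤ d → n ≡ 2 * (2 ^ d + d) →
    LV-OBDD≤ n ½ (SSAₙ d n) (2 ^ ((2 ^ d) / 2 + d + 3))
theorem6 d n 1≤d _ = 2 ^ width , ≤-refl , pobdd , computes (SSAₙ d n) ssa-commits
  where open SSAProgram d n 1≤d
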